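{- Let $k\ge1$. A plane tree is $k$-maximal if and only if every node has degree at most $k$, and it is $k$-minimal if and only if every non-root node has degree less than $k$. Furthermore, each $k$-equivalence class of plane trees has a unique minimal element.
   Context: A binary tree is a rooted plane tree in which every node has $0$ or $2$ ordered children; $\mathcal T_n$ is the set of binary trees with $n+1$ leaves. For binary trees $s,t$, $s\wedge t$ has left subtree $s$ and right subtree $t$ at the root; iterated $\wedge$ is read left to right. For $k\ge1$, a right $k$-rotation replaces a maximal subtree $(t_0\wedge t_1\wedge\cdots\wedge t_k)\wedge t_{k+1}$ by $t_0\wedge(t_1\wedge\cdots\wedge t_{k+1})$; a left $k$-rotation is its inverse. On $\mathcal T_n$, $t\le t'$ in the $k$-associative order iff $t$ is obtained from $t'$ by finitely many left $k$-rotations; $k$-equivalence classes are the connected components of this order (trees related by sequences of $k$-rotations). A plane tree is a rooted tree whose children at each node are linearly ordered; the degree of a node is its number of children. The bijection $\Phi$ from binary trees with $n+1$ leaves to plane trees with $n+1$ nodes: $\Phi$(single leaf) is a single node, and $\Phi(s\wedge t)$ is obtained from $\Phi(s)$ by attaching $\Phi(t)$ as a new rightmost subtree of the root. Plane trees $T,T'$ are $k$-equivalent, resp. satisfy $T\le T'$ in the $k$-associative order, if $\Phi^{ -1}(T),\Phi^{ -1}(T')$ are. A plane tree is $k$-maximal (resp. $k$-minimal) if it is maximal (resp. minimal) in its $k$-equivalence class under this order. -}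

module Defs where

open import Data.Nat using (ℕ; suc; _≤_; _<_)
open import Data.List using (List; []; _∷_; _∷ʳ_; length)
open import Data.List.Relation.Unary.All using (All)
open import Data.Vec using (Vec; []; _∷_)
open import Relation.Binary.PropositionalEquality using (_≡_)
open import Relation.Binary.Construct.Closure.ReflexiveTransitive using (Star)
open import Relation.Binary.Construct.Closure.Equivalence using (EqClosure)

-- Binary trees (every node has 0 or 2 ordered children).
-- T_n = binary trees with n+1 leaves; rotations preserve the number of
-- leaves, so we work with all binary trees at once.

infixl 5 _∧_
data BT : Set where
  leaf : BT
  _∧_  : BT → BT → BT

comb : ∀ {j} → BT → Vec BT j → BT
comb t []       = t
comb t (s ∷ ss) = comb (t ∧ s) ss

-- For k = suc m the root
-- rewrite is
--   (t0 ∧ t1 ∧ … ∧ tk) ∧ t(k+1)  ⟶  t0 ∧ (t1 ∧ … ∧ t(k+1))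
-- where rest = [t2,…,tk] (so t1 ∧ … ∧ t(k+1) = comb t1 rest ∧ t(k+1)).
data RotR : ℕ → BT → BT → Set where
  root  : ∀ {m} (t0 t1 u : BT) (rest : Vec BT m) →
          RotR (suc m) (comb t0 (t1 ∷ rest) ∧ u) (t0 ∧ (comb t1 rest ∧ u))
  left  : ∀ {k s s' t} → RotR k s s' → RotR k (s ∧ t) (s' ∧ t)
  right : ∀ {k s t t'} → RotR k t t' → RotR k (s ∧ t) (s ∧ t')

-- t ≤ t' in the k-associative order iff t is obtained from t' by finitely
-- many left k-rotations, i.e. t' is obtained from t by right k-rotations.
_≤[_]_ : BT → ℕ → BT → Set
t ≤[ k ] t' = Star (RotR k) t t'

_~[_]_ : BT → ℕ → BT → Set
t ~[ k ] t' = EqClosure (RotR k) t t'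

data PT : Set where
  node : List PT → PT

degree : PT → ℕ
degree (node cs) = length cs

addRightmost : PT → PT → PT
addRightmost (node cs) c = node (cs ∷ʳ c)

Φ : BT → PT
Φ leaf    = node []
Φ (s ∧ t) = addRightmost (Φ s) (Φ t)

mutual
  Φ⁻¹ : PT → BT
  Φ⁻¹ (node cs) = Φ⁻¹-children leaf cs

  Φ⁻¹-children : BT → List PT → BT
  Φ⁻¹-children acc []       = acc
  Φ⁻¹-children acc (c ∷ cs) = Φ⁻¹-children (acc ∧ Φ⁻¹ c) cs

_≤ₚ[_]_ : PT → ℕ → PT → Set
T ≤ₚ[ k ] T' = Φ⁻¹ T ≤[ k ] Φ⁻¹ T'

_~ₚ[_]_ : PT → ℕ → PT → Set
T ~ₚ[ k ] T' = Φ⁻¹ T ~[ k ] Φ⁻¹ T'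

KMaximal : ℕ → PT → Set
KMaximal k T = ∀ T' → T ~ₚ[ k ] T' → T ≤ₚ[ k ] T' → T' ≡ T

KMinimal : ℕ → PT → Set
KMinimal k T = ∀ T' → T' ~ₚ[ k ] T → T' ≤ₚ[ k ] T → T' ≡ T

data AllNodes (P : PT → Set) : PT → Set where
  allNodes : ∀ {cs} → P (node cs) → All (AllNodes P) cs → AllNodes P (node cs)

NonRootNodes : (PT → Set) → PT → Set
NonRootNodes P (node cs) = All (AllNodes P) cs

-- Under Φ the degree of a plane node is the length of the left spine of the corresponding
-- binary subtree (the whole tree or a right child).  A right k-rotation applies exactly at a
-- spine longer than k, and it creates a right child of spine at least k; conversely every
-- such right child can be produced by a rotation.  This characterises k-maximal and
-- k-minimal trees.  For uniqueness, `nf` is an invariant of k-rotations from which a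
-- canonical tree is rebuilt; every tree rotates down to it, and a k-minimal tree is its
-- own canonical tree.
module Submission where

open import Defs
open import Data.Nat using (ℕ; zero; suc; _+_; _*_; _∸_; _⊓_; _≤_; _<_; z≤n; s≤s; _≤?_; _<?_; _/_; _%_)
open import Data.Nat.Properties
open import Data.Nat.DivMod using (m%n≤m; m%n<n; m<n⇒m%n≡m; [m+kn]%n≡m%n; m≡m%n+[m/n]*n)
open import Data.Nat.Tactic.RingSolver using (solve-∀)
open import Data.List using (List; []; _∷_; _∷ʳ_; _++_; length; map; take; drop)
open import Data.List.Properties
  using ( length-++; ++-assoc; map-++; ++-identityʳ; length-map
        ; length-take; length-drop; take++drop≡id; take-all; drop-all )
open import Data.List.Relation.Unary.All using (All; []; _∷_)
import Data.List.Relation.Unary.All.Properties as All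
open import Data.Vec using (Vec; []; _∷_) renaming (_∷ʳ_ to _∷ᵛ_)
open import Data.Unit using (⊤; tt)
open import Data.Empty using (⊥-elim)
open import Data.Product using (_×_; _,_; proj₂; Σ-syntax; ∃-syntax)
open import Function using (_∘_)
open import Function.Bundles using (_⇔_; mk⇔; Equivalence)
import Function.Properties.Equivalence as ⇔
open import Level using (Level)
open import Relation.Binary using (Rel)
open import Relation.Binary.PropositionalEquality
open import Relation.Nullary using (¬_; yes; no)
open import Relation.Binary.Construct.Closure.ReflexiveTransitive as Star using (Star; ε; _◅_)
open import Relation.Binary.Construct.Closure.ReflexiveTransitive.Properties using (module StarReasoning)
open import Relation.Binary.Construct.Closure.Symmetric using (fwd; bwd)

module _ {a ℓ : Level} {A : Set a} {R : Rel A ℓ} where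

  star-from-sink : ∀ {x y} → (∀ z → ¬ R x z) → Star R x y → x ≡ y
  star-from-sink _    ε       = refl
  star-from-sink sink (r ◅ _) = ⊥-elim (sink _ r)

  star-to-source : ∀ {x y} → (∀ z → ¬ R z y) → Star R x y → x ≡ y
  star-to-source _      ε        = refl
  star-to-source source (r ◅ rs) with star-to-source source rs
  ... | refl = ⊥-elim (source _ r)

module _ {a : Level} {A : Set a} where

  take-++ˡ : ∀ n (xs ys : List A) → n ≤ length xs → take n (xs ++ ys) ≡ take n xs
  take-++ˡ zero    xs       ys _         = refl
  take-++ˡ (suc n) (x ∷ xs) ys (s≤s n≤) = cong (x ∷_) (take-++ˡ n xs ys n≤)

  drop-++ˡ : ∀ n (xs ys : List A) → n ≤ length xs → drop n (xs ++ ys) ≡ drop n xs ++ ys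
  drop-++ˡ zero    xs       ys _         = refl
  drop-++ˡ (suc n) (x ∷ xs) ys (s≤s n≤) = drop-++ˡ n xs ys n≤

spine : BT → ℕ
spine leaf    = 0
spine (a ∧ _) = suc (spine a)

combList : BT → List BT → BT
combList t []       = t
combList t (y ∷ ys) = combList (t ∧ y) ys

combList-++ : ∀ t xs ys → combList t (xs ++ ys) ≡ combList (combList t xs) ys
combList-++ t []       ys = refl
combList-++ t (x ∷ xs) ys = combList-++ (t ∧ x) xs ys

spine-combList : ∀ t ys → spine (combList t ys) ≡ spine t + length ys
spine-combList t []       = sym (+-identityʳ _)
spine-combList t (y ∷ ys) = trans (spine-combList (t ∧ y) ys) (sym (+-suc _ _))

spine-comb : ∀ {n} t (v : Vec BT n) → spine (comb t v) ≡ spine t + n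
spine-comb t []      = sym (+-identityʳ _)
spine-comb t (y ∷ v) = trans (spine-comb (t ∧ y) v) (sym (+-suc _ _))

comb-∷ʳ : ∀ {n} t (v : Vec BT n) y → comb t (v ∷ᵛ y) ≡ comb t v ∧ y
comb-∷ʳ t []      y = refl
comb-∷ʳ t (x ∷ v) y = comb-∷ʳ (t ∧ x) v y

spine-view : ∀ n t → n ≤ spine t → ∃[ c ] Σ[ v ∈ Vec BT n ] t ≡ comb c v
spine-view zero    t       _         = t , [] , refl
spine-view (suc n) (a ∧ y) (s≤s n≤) with spine-view n a n≤
... | c , v , refl = c , v ∷ᵛ y , sym (comb-∷ʳ c v y)

combList-as-comb : ∀ n ys → length ys ≡ suc n →
                   Σ[ v ∈ Vec BT n ] ∃[ u ] ∀ t → combList t ys ≡ comb t v ∧ u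
combList-as-comb zero    (y ∷ [])         refl = [] , y , λ _ → refl
combList-as-comb (suc n) (y ∷ ys@(_ ∷ _)) eq   with combList-as-comb n ys (suc-injective eq)
... | v , u , split = y ∷ v , u , λ t → split (t ∧ y)

∧-injectiveʳ : ∀ {s t s' t'} → s ∧ t ≡ s' ∧ t' → t ≡ t'
∧-injectiveʳ refl = refl

∧-injectiveˡ : ∀ {s t s' t'} → s ∧ t ≡ s' ∧ t' → s ≡ s'
∧-injectiveˡ refl = refl

t≢s∧t : ∀ s t → t ≢ s ∧ t
t≢s∧t s (a ∧ b) eq = t≢s∧t a b (∧-injectiveʳ eq)

rotation-irreflexive : ∀ {k s t} → RotR k s t → s ≢ t
rotation-irreflexive (root t0 t1 u rest) eq = t≢s∧t _ u (∧-injectiveʳ eq)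
rotation-irreflexive (left r)            eq = rotation-irreflexive r (∧-injectiveˡ eq)
rotation-irreflexive (right r)           eq = rotation-irreflexive r (∧-injectiveʳ eq)

star-∧ˡ : ∀ {k s s'} t → s ≤[ k ] s' → (s ∧ t) ≤[ k ] (s' ∧ t)
star-∧ˡ t = Star.gmap (_∧ t) left

star-∧ʳ : ∀ {k t t'} s → t ≤[ k ] t' → (s ∧ t) ≤[ k ] (s ∧ t')
star-∧ʳ s = Star.gmap (s ∧_) right

star-combList : ∀ {k s s'} ys → s ≤[ k ] s' → combList s ys ≤[ k ] combList s' ys
star-combList []       s≤s' = s≤s'
star-combList (y ∷ ys) s≤s' = star-combList ys (star-∧ˡ y s≤s')

Φ⁻¹-children≡combList : ∀ acc cs → Φ⁻¹-children acc cs ≡ combList acc (map Φ⁻¹ cs)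
Φ⁻¹-children≡combList acc []       = refl
Φ⁻¹-children≡combList acc (c ∷ cs) = Φ⁻¹-children≡combList (acc ∧ Φ⁻¹ c) cs

Φ⁻¹-node : ∀ cs → Φ⁻¹ (node cs) ≡ combList leaf (map Φ⁻¹ cs)
Φ⁻¹-node = Φ⁻¹-children≡combList leaf

spine-Φ⁻¹ : ∀ T → spine (Φ⁻¹ T) ≡ degree T
spine-Φ⁻¹ (node cs) = trans (cong spine (Φ⁻¹-node cs))
                            (trans (spine-combList leaf (map Φ⁻¹ cs)) (length-map Φ⁻¹ cs))

Φ⁻¹-addRightmost : ∀ T c → Φ⁻¹ (addRightmost T c) ≡ Φ⁻¹ T ∧ Φ⁻¹ c
Φ⁻¹-addRightmost (node cs) c = begin
  Φ⁻¹-children leaf (cs ∷ʳ c)               ≡⟨ Φ⁻¹-children≡combList leaf (cs ∷ʳ c) ⟩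
  combList leaf (map Φ⁻¹ (cs ∷ʳ c))         ≡⟨ cong (combList leaf) (map-++ Φ⁻¹ cs (c ∷ [])) ⟩
  combList leaf (map Φ⁻¹ cs ∷ʳ Φ⁻¹ c)       ≡⟨ combList-++ leaf (map Φ⁻¹ cs) (Φ⁻¹ c ∷ []) ⟩
  combList leaf (map Φ⁻¹ cs) ∧ Φ⁻¹ c        ≡⟨ cong (_∧ Φ⁻¹ c) (sym (Φ⁻¹-node cs)) ⟩
  Φ⁻¹ (node cs) ∧ Φ⁻¹ c                     ∎
  where open ≡-Reasoning

Φ⁻¹∘Φ : ∀ t → Φ⁻¹ (Φ t) ≡ t
Φ⁻¹∘Φ leaf    = refl
Φ⁻¹∘Φ (s ∧ t) = trans (Φ⁻¹-addRightmost (Φ s) (Φ t)) (cong₂ _∧_ (Φ⁻¹∘Φ s) (Φ⁻¹∘Φ t))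

mutual
  Φ∘Φ⁻¹ : ∀ T → Φ (Φ⁻¹ T) ≡ T
  Φ∘Φ⁻¹ (node cs) = Φ-Φ⁻¹-children leaf [] cs refl

  Φ-Φ⁻¹-children : ∀ acc ds cs → Φ acc ≡ node ds → Φ (Φ⁻¹-children acc cs) ≡ node (ds ++ cs)
  Φ-Φ⁻¹-children acc ds []       eq = trans eq (cong node (sym (++-identityʳ ds)))
  Φ-Φ⁻¹-children acc ds (c ∷ cs) eq =
    trans (Φ-Φ⁻¹-children (acc ∧ Φ⁻¹ c) (ds ∷ʳ c) cs step) (cong node (++-assoc ds (c ∷ []) cs))
    where
    step : Φ (acc ∧ Φ⁻¹ c) ≡ node (ds ∷ʳ c)
    step rewrite eq | Φ∘Φ⁻¹ c = refl

Φ⁻¹-injective : ∀ {T T'} → Φ⁻¹ T ≡ Φ⁻¹ T' → T ≡ T'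
Φ⁻¹-injective {T} {T'} eq = trans (sym (Φ∘Φ⁻¹ T)) (trans (cong Φ eq) (Φ∘Φ⁻¹ T'))

-- Spine conditions and the degrees of plane trees

RightSpines : (ℕ → Set) → BT → Set
RightSpines P leaf    = ⊤
RightSpines P (a ∧ b) = RightSpines P a × P (spine b) × RightSpines P b

AllSpines : (ℕ → Set) → BT → Set
AllSpines P t = P (spine t) × RightSpines P t

module _ {P : ℕ → Set} where

  rightSpines-combList⁺ : ∀ {t} ys → RightSpines P t → All (AllSpines P) ys → RightSpines P (combList t ys)
  rightSpines-combList⁺ []       r []       = r
  rightSpines-combList⁺ (y ∷ ys) r (g ∷ gs) = rightSpines-combList⁺ ys (r , g) gs

  rightSpines-combList⁻ : ∀ t ys → RightSpines P (combList t ys) → RightSpines P t × All (AllSpines P) ys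
  rightSpines-combList⁻ t []       r = r , []
  rightSpines-combList⁻ t (y ∷ ys) r with rightSpines-combList⁻ (t ∧ y) ys r
  ... | (rt , g) , gs = rt , g ∷ gs

  mutual
    allNodes⇒allSpines : ∀ T → AllNodes (P ∘ degree) T → AllSpines P (Φ⁻¹ T)
    allNodes⇒allSpines T@(node _) (allNodes p as) =
      subst P (sym (spine-Φ⁻¹ T)) p , nonRootNodes⇒rightSpines T as

    nonRootNodes⇒rightSpines : ∀ T → NonRootNodes (P ∘ degree) T → RightSpines P (Φ⁻¹ T)
    nonRootNodes⇒rightSpines (node cs) as =
      subst (RightSpines P) (sym (Φ⁻¹-node cs))
            (rightSpines-combList⁺ (map Φ⁻¹ cs) tt (children⇒allSpines cs as))

    children⇒allSpines : ∀ cs → All (AllNodes (P ∘ degree)) cs → All (AllSpines P) (map Φ⁻¹ cs)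
    children⇒allSpines []       []       = []
    children⇒allSpines (c ∷ cs) (a ∷ as) = allNodes⇒allSpines c a ∷ children⇒allSpines cs as

  mutual
    allSpines⇒allNodes : ∀ T → AllSpines P (Φ⁻¹ T) → AllNodes (P ∘ degree) T
    allSpines⇒allNodes T@(node _) (p , r) =
      allNodes (subst P (spine-Φ⁻¹ T) p) (rightSpines⇒nonRootNodes T r)

    rightSpines⇒nonRootNodes : ∀ T → RightSpines P (Φ⁻¹ T) → NonRootNodes (P ∘ degree) T
    rightSpines⇒nonRootNodes (node cs) r =
      allSpines⇒children cs
        (proj₂ (rightSpines-combList⁻ leaf (map Φ⁻¹ cs) (subst (RightSpines P) (Φ⁻¹-node cs) r)))

    allSpines⇒children : ∀ cs → All (AllSpines P) (map Φ⁻¹ cs) → All (AllNodes (P ∘ degree)) cs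
    allSpines⇒children []       []       = []
    allSpines⇒children (c ∷ cs) (g ∷ gs) = allSpines⇒allNodes c g ∷ allSpines⇒children cs gs

  allNodes⇔allSpines : ∀ T → AllNodes (P ∘ degree) T ⇔ AllSpines P (Φ⁻¹ T)
  allNodes⇔allSpines T = mk⇔ (allNodes⇒allSpines T) (allSpines⇒allNodes T)

  nonRootNodes⇔rightSpines : ∀ T → NonRootNodes (P ∘ degree) T ⇔ RightSpines P (Φ⁻¹ T)
  nonRootNodes⇔rightSpines T = mk⇔ (nonRootNodes⇒rightSpines T) (rightSpines⇒nonRootNodes T)

-- Extremal trees are those admitting no rotation

kMaximal⇔noRotationFrom : ∀ k T → KMaximal k T ⇔ (∀ t → ¬ RotR k (Φ⁻¹ T) t)
kMaximal⇔noRotationFrom k T = mk⇔ noRotation maximal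
  where
  noRotation : KMaximal k T → ∀ t → ¬ RotR k (Φ⁻¹ T) t
  noRotation isMax t r = rotation-irreflexive r (trans (cong Φ⁻¹ (sym Φt≡T)) (Φ⁻¹∘Φ t))
    where
    r' : RotR k (Φ⁻¹ T) (Φ⁻¹ (Φ t))
    r' = subst (RotR k (Φ⁻¹ T)) (sym (Φ⁻¹∘Φ t)) r
    Φt≡T : Φ t ≡ T
    Φt≡T = isMax (Φ t) (fwd r' ◅ ε) (r' ◅ ε)

  maximal : (∀ t → ¬ RotR k (Φ⁻¹ T) t) → KMaximal k T
  maximal sink T' _ T≤T' = sym (Φ⁻¹-injective (star-from-sink sink T≤T'))

kMinimal⇔noRotationInto : ∀ k T → KMinimal k T ⇔ (∀ t → ¬ RotR k t (Φ⁻¹ T))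
kMinimal⇔noRotationInto k T = mk⇔ noRotation minimal
  where
  noRotation : KMinimal k T → ∀ t → ¬ RotR k t (Φ⁻¹ T)
  noRotation isMin t r = rotation-irreflexive r (trans (sym (Φ⁻¹∘Φ t)) (cong Φ⁻¹ Φt≡T))
    where
    r' : RotR k (Φ⁻¹ (Φ t)) (Φ⁻¹ T)
    r' = subst (λ s → RotR k s (Φ⁻¹ T)) (sym (Φ⁻¹∘Φ t)) r
    Φt≡T : Φ t ≡ T
    Φt≡T = isMin (Φ t) (fwd r' ◅ ε) (r' ◅ ε)

  minimal : (∀ t → ¬ RotR k t (Φ⁻¹ T)) → KMinimal k T
  minimal source T' _ T'≤T = Φ⁻¹-injective (star-to-source source T'≤T)

module _ {m : ℕ} where

  rightSpines⇒noRotationInto : ∀ {s t} → RightSpines (_< suc m) t → ¬ RotR (suc m) s t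
  rightSpines⇒noRotationInto (_ , spine<k , _) (root t0 t1 u rest) =
    <⇒≱ (≤-pred spine<k) (≤-trans (m≤n+m m (spine t1)) (≤-reflexive (sym (spine-comb t1 rest))))
  rightSpines⇒noRotationInto (ra , _)      (left r)  = rightSpines⇒noRotationInto ra r
  rightSpines⇒noRotationInto (_ , _ , rb)  (right r) = rightSpines⇒noRotationInto rb r

  spine-rightChild< : ∀ a b → (∀ s → ¬ RotR (suc m) s (a ∧ b)) → spine b < suc m
  spine-rightChild< a leaf    _      = s≤s z≤n
  spine-rightChild< a (b ∧ u) source with spine b <? m
  ... | yes spine<m = s≤s spine<m
  ... | no spine≮m with spine-view m b (≮⇒≥ spine≮m)
  ...   | c , v , refl = ⊥-elim (source _ (root a c u v))

  noRotationInto⇒rightSpines : ∀ t → (∀ s → ¬ RotR (suc m) s t) → RightSpines (_< suc m) t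
  noRotationInto⇒rightSpines leaf    _      = tt
  noRotationInto⇒rightSpines (a ∧ b) source =
    noRotationInto⇒rightSpines a (λ _ r → source _ (left r)) ,
    spine-rightChild< a b source ,
    noRotationInto⇒rightSpines b (λ _ r → source _ (right r))

  allSpines⇒noRotationFrom : ∀ {s t} → AllSpines (_≤ suc m) t → ¬ RotR (suc m) t s
  allSpines⇒noRotationFrom (spine≤k , _) (root t0 t1 u rest) =
    <⇒≱ (≤-trans (s≤s (m≤n+m m (spine t0))) (≤-reflexive (sym (spine-comb (t0 ∧ t1) rest))))
        (≤-pred spine≤k)
  allSpines⇒noRotationFrom (spine≤k , ra , _) (left r) =
    allSpines⇒noRotationFrom (≤-trans (n≤1+n _) spine≤k , ra) r
  allSpines⇒noRotationFrom (_ , _ , ab) (right r) = allSpines⇒noRotationFrom ab r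

  noRotationFrom⇒allSpines : ∀ t → (∀ s → ¬ RotR (suc m) t s) → AllSpines (_≤ suc m) t
  noRotationFrom⇒allSpines leaf    _ = z≤n , tt
  noRotationFrom⇒allSpines (a ∧ b) sink with spine a ≤? m
  ... | yes spine≤m = s≤s spine≤m ,
                      proj₂ (noRotationFrom⇒allSpines a (λ _ r → sink _ (left r))) ,
                      noRotationFrom⇒allSpines b (λ _ r → sink _ (right r))
  ... | no spine≰m with spine-view (suc m) a (≰⇒> spine≰m)
  ...   | t0 , t1 ∷ rest , refl = ⊥-elim (sink _ (root t0 t1 b rest))

  noRotationInto⇔rightSpines : ∀ t → (∀ s → ¬ RotR (suc m) s t) ⇔ RightSpines (_< suc m) t
  noRotationInto⇔rightSpines t =
    mk⇔ (noRotationInto⇒rightSpines t) (λ r s → rightSpines⇒noRotationInto r)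

  noRotationFrom⇔allSpines : ∀ t → (∀ s → ¬ RotR (suc m) t s) ⇔ AllSpines (_≤ suc m) t
  noRotationFrom⇔allSpines t =
    mk⇔ (noRotationFrom⇒allSpines t) (λ a s → allSpines⇒noRotationFrom a)

  kMaximal⇔allSpines : ∀ T → KMaximal (suc m) T ⇔ AllSpines (_≤ suc m) (Φ⁻¹ T)
  kMaximal⇔allSpines T =
    ⇔.trans (kMaximal⇔noRotationFrom (suc m) T) (noRotationFrom⇔allSpines (Φ⁻¹ T))

  kMinimal⇔rightSpines : ∀ T → KMinimal (suc m) T ⇔ RightSpines (_< suc m) (Φ⁻¹ T)
  kMinimal⇔rightSpines T =
    ⇔.trans (kMinimal⇔noRotationInto (suc m) T) (noRotationInto⇔rightSpines (Φ⁻¹ T))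

-- The normal form of a k-equivalence class

module NormalForm (m : ℕ) where

  private
    K : ℕ
    K = suc m

  -- A right child whose spine carries the subtrees ys keeps the first (length ys mod K)
  -- of them; the others, a multiple of K in number, are hoisted to its parent.
  hoist : List BT → List BT
  hoist ys = combList leaf (take r ys) ∷ drop r ys
    where r = length ys % K

  nf : BT → List BT
  nf leaf    = []
  nf (a ∧ b) = nf a ++ hoist (nf b)

  normalise : BT → BT
  normalise t = combList leaf (nf t)

  hoist-++ : ∀ xs ys j → length ys ≡ j * K → hoist (xs ++ ys) ≡ hoist xs ++ ys
  hoist-++ xs ys j eq =
    trans (cong (λ r → combList leaf (take r (xs ++ ys)) ∷ drop r (xs ++ ys)) same-remainder)
          (cong₂ (λ zs ws → combList leaf zs ∷ ws) (take-++ˡ r xs ys r≤) (drop-++ˡ r xs ys r≤))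
    where
    r = length xs % K
    r≤ : r ≤ length xs
    r≤ = m%n≤m (length xs) K
    same-remainder : length (xs ++ ys) % K ≡ r
    same-remainder rewrite length-++ xs {ys} | eq = [m+kn]%n≡m%n (length xs) j K

  length-hoist : ∀ xs → length (hoist xs) ≡ suc (length xs / K * K)
  length-hoist xs = cong suc (begin
    length (drop r xs)                   ≡⟨ length-drop r xs ⟩
    length xs ∸ r                        ≡⟨ cong (_∸ r) (m≡m%n+[m/n]*n (length xs) K) ⟩
    r + length xs / K * K ∸ r            ≡⟨ m+n∸m≡n r _ ⟩
    length xs / K * K                    ∎)
    where
    open ≡-Reasoning
    r = length xs % K

  hoist-short : ∀ ys → length ys < K → hoist ys ≡ combList leaf ys ∷ []
  hoist-short ys ys<K rewrite m<n⇒m%n≡m ys<K =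
    cong₂ (λ zs ws → combList leaf zs ∷ ws) (take-all _ ys ≤-refl) (drop-all _ ys ≤-refl)

  hoistAll : ∀ {n} → Vec BT n → List BT
  hoistAll []      = []
  hoistAll (y ∷ v) = hoist (nf y) ++ hoistAll v

  nf-comb : ∀ {n} t (v : Vec BT n) → nf (comb t v) ≡ nf t ++ hoistAll v
  nf-comb t []      = sym (++-identityʳ _)
  nf-comb t (y ∷ v) = trans (nf-comb (t ∧ y) v) (++-assoc (nf t) _ _)

  length-hoistAll : ∀ {n} (v : Vec BT n) → ∃[ j ] length (hoistAll v) ≡ n + j * K
  length-hoistAll []              = 0 , refl
  length-hoistAll {suc n} (y ∷ v) with length-hoistAll v
  ... | j , eq = length (nf y) / K + j , (begin
    length (hoist (nf y) ++ hoistAll v)            ≡⟨ length-++ (hoist (nf y)) ⟩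
    length (hoist (nf y)) + length (hoistAll v)    ≡⟨ cong₂ _+_ (length-hoist (nf y)) eq ⟩
    suc (length (nf y) / K * K) + (n + j * K)      ≡⟨ 1+qk+[n+jk]≡1+n+[q+j]k (length (nf y) / K) n j K ⟩
    suc n + (length (nf y) / K + j) * K            ∎)
    where
    open ≡-Reasoning
    1+qk+[n+jk]≡1+n+[q+j]k : ∀ q n j k → suc (q * k) + (n + j * k) ≡ suc n + (q + j) * k
    1+qk+[n+jk]≡1+n+[q+j]k = solve-∀

  -- The k trees t2 … tk, u moved by a root rotation contribute k hoisted lists, each of
  -- length 1 mod K; together they pass unchanged through the hoisting in t1.
  rotation-preserves-nf : ∀ {s t} → RotR K s t → nf s ≡ nf t
  rotation-preserves-nf (left {t = t} r)  = cong (_++ hoist (nf t)) (rotation-preserves-nf r)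
  rotation-preserves-nf (right {s = s} r) = cong (λ z → nf s ++ hoist z) (rotation-preserves-nf r)
  rotation-preserves-nf (root t0 t1 u rest) with length-hoistAll rest
  ... | j , eq = begin
    nf (comb (t0 ∧ t1) rest) ++ hoist (nf u)
      ≡⟨ cong (_++ hoist (nf u)) (nf-comb (t0 ∧ t1) rest) ⟩
    ((nf t0 ++ hoist (nf t1)) ++ hoistAll rest) ++ hoist (nf u)
      ≡⟨ trans (++-assoc (nf t0 ++ hoist (nf t1)) _ _) (++-assoc (nf t0) _ _) ⟩
    nf t0 ++ hoist (nf t1) ++ hoistAll rest ++ hoist (nf u)
      ≡⟨ cong (nf t0 ++_) (sym (hoist-++ (nf t1) _ (suc (j + length (nf u) / K)) length-moved)) ⟩
    nf t0 ++ hoist (nf t1 ++ hoistAll rest ++ hoist (nf u))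
      ≡⟨ cong (λ z → nf t0 ++ hoist z) (sym (++-assoc (nf t1) _ _)) ⟩
    nf t0 ++ hoist ((nf t1 ++ hoistAll rest) ++ hoist (nf u))
      ≡⟨ cong (λ z → nf t0 ++ hoist (z ++ hoist (nf u))) (sym (nf-comb t1 rest)) ⟩
    nf t0 ++ hoist (nf (comb t1 rest) ++ hoist (nf u))
      ∎
    where
    open ≡-Reasoning
    m+jK+[1+qK]≡[1+j+q]K : ∀ m j q → (m + j * suc m) + suc (q * suc m) ≡ suc (j + q) * suc m
    m+jK+[1+qK]≡[1+j+q]K = solve-∀
    length-moved : length (hoistAll rest ++ hoist (nf u)) ≡ suc (j + length (nf u) / K) * K
    length-moved = trans (length-++ (hoistAll rest))
      (trans (cong₂ _+_ eq (length-hoist (nf u))) (m+jK+[1+qK]≡[1+j+q]K m j (length (nf u) / K)))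

  equivalence-preserves-nf : ∀ {s t} → s ~[ K ] t → nf s ≡ nf t
  equivalence-preserves-nf ε            = refl
  equivalence-preserves-nf (fwd r ◅ rs) = trans (rotation-preserves-nf r) (equivalence-preserves-nf rs)
  equivalence-preserves-nf (bwd r ◅ rs) = trans (sym (rotation-preserves-nf r)) (equivalence-preserves-nf rs)

  rotate-block : ∀ zs → length zs ≡ K → ∀ x c → RotR K (combList (x ∧ c) zs) (x ∧ combList c zs)
  rotate-block zs eq x c with combList-as-comb m zs eq
  ... | rest , u , split rewrite split (x ∧ c) | split c = root x c u rest

  rotate-blocks : ∀ q ws → length ws ≡ q * K → ∀ x c → combList (x ∧ c) ws ≤[ K ] (x ∧ combList c ws)
  rotate-blocks zero    [] _  x c = ε
  rotate-blocks (suc q) ws eq x c = begin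
    combList (x ∧ c) ws
      ≡⟨ cong (combList (x ∧ c)) (sym (take++drop≡id K ws)) ⟩
    combList (x ∧ c) (block ++ rest)
      ≡⟨ combList-++ (x ∧ c) block rest ⟩
    combList (combList (x ∧ c) block) rest
      ⟶*⟨ star-combList rest (rotate-block block length-block x c ◅ ε) ⟩
    combList (x ∧ combList c block) rest
      ⟶*⟨ rotate-blocks q rest length-rest x (combList c block) ⟩
    x ∧ combList (combList c block) rest
      ≡⟨ cong (x ∧_) (sym (combList-++ c block rest)) ⟩
    x ∧ combList c (block ++ rest)
      ≡⟨ cong (λ zs → x ∧ combList c zs) (take++drop≡id K ws) ⟩
    x ∧ combList c ws
      ∎
    where
    open StarReasoning (RotR K)
    block rest : List BT
    block = take K ws
    rest  = drop K ws
    length-block : length block ≡ K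
    length-block = trans (length-take K ws) (m≤n⇒m⊓n≡m (subst (K ≤_) (sym eq) (m≤m+n K (q * K))))
    length-rest : length rest ≡ q * K
    length-rest = trans (length-drop K ws) (trans (cong (_∸ K) eq) (m+n∸m≡n K (q * K)))

  combList-hoist≤ : ∀ x ys → combList x (hoist ys) ≤[ K ] (x ∧ combList leaf ys)
  combList-hoist≤ x ys = begin
    combList (x ∧ combList leaf (take r ys)) (drop r ys)
      ⟶*⟨ rotate-blocks (length ys / K) (drop r ys) (suc-injective (length-hoist ys)) x _ ⟩
    x ∧ combList (combList leaf (take r ys)) (drop r ys)
      ≡⟨ cong (x ∧_) (sym (combList-++ leaf (take r ys) (drop r ys))) ⟩
    x ∧ combList leaf (take r ys ++ drop r ys)
      ≡⟨ cong (λ zs → x ∧ combList leaf zs) (take++drop≡id r ys) ⟩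
    x ∧ combList leaf ys
      ∎
    where
    open StarReasoning (RotR K)
    r = length ys % K

  normalise≤ : ∀ t → normalise t ≤[ K ] t
  normalise≤ leaf    = ε
  normalise≤ (a ∧ b) = begin
    combList leaf (nf a ++ hoist (nf b))   ≡⟨ combList-++ leaf (nf a) (hoist (nf b)) ⟩
    combList (normalise a) (hoist (nf b))  ⟶*⟨ combList-hoist≤ (normalise a) (nf b) ⟩
    normalise a ∧ normalise b              ⟶*⟨ star-∧ˡ (normalise b) (normalise≤ a) ⟩
    a ∧ normalise b                        ⟶*⟨ star-∧ʳ a (normalise≤ b) ⟩
    a ∧ b                                  ∎
    where open StarReasoning (RotR K)

  hoist-allSpines : ∀ ys → All (AllSpines (_< K)) ys → All (AllSpines (_< K)) (hoist ys)
  hoist-allSpines ys gs =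
    (spine-kept<K , rightSpines-combList⁺ (take r ys) tt (All.take⁺ r gs)) ∷ All.drop⁺ r gs
    where
    r = length ys % K
    spine-kept<K : spine (combList leaf (take r ys)) < K
    spine-kept<K = begin-strict
      spine (combList leaf (take r ys)) ≡⟨ spine-combList leaf (take r ys) ⟩
      length (take r ys)                ≡⟨ length-take r ys ⟩
      r ⊓ length ys                     ≤⟨ m⊓n≤m r (length ys) ⟩
      r                                 <⟨ m%n<n (length ys) K ⟩
      K                                 ∎
      where open ≤-Reasoning

  allSpines-nf : ∀ t → All (AllSpines (_< K)) (nf t)
  allSpines-nf leaf    = []
  allSpines-nf (a ∧ b) = All.++⁺ (allSpines-nf a) (hoist-allSpines (nf b) (allSpines-nf b))

  rightSpines-normalise : ∀ t → RightSpines (_< K) (normalise t)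
  rightSpines-normalise t = rightSpines-combList⁺ (nf t) tt (allSpines-nf t)

  normalise-fixed : ∀ t → RightSpines (_< K) t → normalise t ≡ t
  normalise-fixed leaf    _                     = refl
  normalise-fixed (a ∧ b) (ra , spine-b<K , rb) = begin
    combList leaf (nf a ++ hoist (nf b))   ≡⟨ combList-++ leaf (nf a) (hoist (nf b)) ⟩
    combList (normalise a) (hoist (nf b))  ≡⟨ cong (combList (normalise a)) (hoist-short (nf b) length-nf<K) ⟩
    normalise a ∧ normalise b              ≡⟨ cong₂ _∧_ (normalise-fixed a ra) (normalise-fixed b rb) ⟩
    a ∧ b                                  ∎
    where
    open ≡-Reasoning
    length-nf<K : length (nf b) < K
    length-nf<K = subst (_< K)
      (trans (cong spine (sym (normalise-fixed b rb))) (spine-combList leaf (nf b))) spine-b<K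

  reduced≡normalise : ∀ {s t} → RightSpines (_< K) s → s ~[ K ] t → s ≡ normalise t
  reduced≡normalise {s} r s~t =
    trans (sym (normalise-fixed s r)) (cong (combList leaf) (equivalence-preserves-nf s~t))

  canonical : PT → PT
  canonical T = Φ (normalise (Φ⁻¹ T))

  kMinimal-canonical : ∀ T → KMinimal K (canonical T)
  kMinimal-canonical T = Equivalence.from (kMinimal⇔rightSpines (canonical T))
    (subst (RightSpines (_< K)) (sym (Φ⁻¹∘Φ _)) (rightSpines-normalise (Φ⁻¹ T)))

  canonical~ : ∀ T → canonical T ~ₚ[ K ] T
  canonical~ T = subst (_~[ K ] Φ⁻¹ T) (sym (Φ⁻¹∘Φ _)) (Star.map fwd (normalise≤ (Φ⁻¹ T)))

  kMinimal≡canonical : ∀ {M T} → KMinimal K M → M ~ₚ[ K ] T → M ≡ canonical T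
  kMinimal≡canonical {M} M-minimal M~T = Φ⁻¹-injective (trans
    (reduced≡normalise (Equivalence.to (kMinimal⇔rightSpines M) M-minimal) M~T) (sym (Φ⁻¹∘Φ _)))

proposition2p8 : (k : ℕ) → 1 ≤ k →
    ((T : PT) → KMaximal k T ⇔ AllNodes (λ S → degree S ≤ k) T)
    × ((T : PT) → KMinimal k T ⇔ NonRootNodes (λ S → degree S < k) T)
    × ((T : PT) → ∃[ M ] (KMinimal k M × M ~ₚ[ k ] T
    × ((M' : PT) → KMinimal k M' → M' ~ₚ[ k ] T → M' ≡ M)))
proposition2p8 (suc m) _ =
    (λ T → ⇔.trans (kMaximal⇔allSpines T) (⇔.sym (allNodes⇔allSpines T)))
  , (λ T → ⇔.trans (kMinimal⇔rightSpines T) (⇔.sym (nonRootNodes⇔rightSpines T)))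
  , (λ T → canonical T , kMinimal-canonical T , canonical~ T , λ _ → kMinimal≡canonical {T = T})
  where open NormalForm m
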